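{- Let $\mathcal{A}\subseteq\{\mathsf{N},\mathsf{M},\mathsf{C}\}$. If a sequent $\Gamma\Rightarrow\Delta$ is derivable (as a one-component linear nested sequent) in $\mathsf{LNS}_{\mathsf{E}\mathcal{A}}$ extended with contraction, then it is derivable in the sequent calculus $\mathsf{G}_{\mathsf{E}\mathcal{A}}$ extended with contraction. Hence, if $\;\Rightarrow A$ is derivable in $\mathsf{LNS}_{\mathsf{E}\mathcal{A}}$ extended with contraction and weakening, then $A\in\mathsf{E}\mathcal{A}$.
   Context: Formulas: propositional variables, $\bot,\top,\neg,\land,\lor,\to,\Box$. $\mathsf{E}\mathcal{A}$ is the smallest set containing the propositional tautologies and the axioms in $\mathcal{A}$ ($\mathsf{M}: \Box(A\land B)\to(\Box A\land\Box B)$, $\mathsf{C}: (\Box A\land\Box B)\to\Box(A\land B)$, $\mathsf{N}: \Box\top$), closed under modus ponens and rule (E): from $A\to B$ and $B\to A$ infer $\Box A\to\Box B$. Structures: $\mathcal{X}::=\Gamma\Rightarrow\Delta\mid\Gamma\Rightarrow\Delta\,/_{\mathsf e}(\Sigma\Rightarrow\Pi;\Omega\Rightarrow\Theta)\mid\Gamma\Rightarrow\Delta\,/\,\mathcal{X}$ (finite multisets); $\mathcal{S}\{\Gamma\Rightarrow\Delta\}$ has a distinguished component, $\mathcal{G}/\Gamma\Rightarrow\Delta$ has last component $\Gamma\Rightarrow\Delta$. $\mathsf{LNS}_{\mathsf{E}\mathcal{A}}$: propositional rules (zero-premiss $\mathcal{S}\{\Gamma,p\Rightarrow p,\Delta\}$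 with $p$ atomic, $\mathcal{S}\{\Gamma,\bot\Rightarrow\Delta\}$, $\mathcal{S}\{\Gamma\Rightarrow\top,\Delta\}$, and the standard two-sided invertible rules for $\neg,\land,\lor,\to$ on one component), not applicable to sequents inside $/_{\mathsf e}$; $\Box^{\mathsf e}_R$: $\mathcal{G}/\Gamma\Rightarrow\Delta/_{\mathsf e}(\Rightarrow B;B\Rightarrow)$ / $\mathcal{G}/\Gamma\Rightarrow\Box B,\Delta$; $\Box^{\mathsf e}_L$: $\mathcal{G}/\Gamma\Rightarrow\Delta/\Sigma,A\Rightarrow\Pi$ and $\mathcal{G}/\Gamma\Rightarrow\Delta/\Omega\Rightarrow A,\Theta$ / $\mathcal{G}/\Gamma,\Box A\Rightarrow\Delta/_{\mathsf e}(\Sigma\Rightarrow\Pi;\Omega\Rightarrow\Theta)$; if $\mathsf{N}\in\mathcal{A}$: $\mathcal{G}/\Gamma\Rightarrow\Delta/\Rightarrow B$ / $\mathcal{G}/\Gamma\Rightarrow\Box B,\Delta$; if $\mathsf{M}\in\mathcal{A}$: $\mathcal{G}/_{\mathsf e}(\Sigma\Rightarrow\Pi;\Omega,\bot\Rightarrow\Theta)$ / $\mathcal{G}/_{\mathsf e}(\Sigma\Rightarrow\Pi;\Omega\Rightarrow\Theta)$; if $\mathsf{C}\in\mathcal{A}$: $\mathcal{G}/\Gamma\Rightarrow\Delta/_{\mathsf e}(\Sigma,A\Rightarrow\Pi;\Omega\Rightarrow\Theta)$ and $\mathcal{G}/\Gamma\Rightarrow\Delta/\Omega\Rightarrow A,\Theta$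 / $\mathcal{G}/\Gamma,\Box A\Rightarrow\Delta/_{\mathsf e}(\Sigma\Rightarrow\Pi;\Omega\Rightarrow\Theta)$. Contraction and weakening: usual left/right rules inside a component. Sequent calculus $\mathsf{G}$: the same propositional rules on plain sequents. Modal sequent rules: (E): from $A\Rightarrow B$ and $B\Rightarrow A$ infer $\Gamma,\Box A\Rightarrow\Box B,\Delta$; (M): from $A\Rightarrow B$ infer $\Gamma,\Box A\Rightarrow\Box B,\Delta$; (N): from $\Rightarrow A$ infer $\Gamma\Rightarrow\Box A,\Delta$; ($\mathsf{E}n$): from $A_1,\dots,A_n\Rightarrow B$ and $B\Rightarrow A_1$, ..., $B\Rightarrow A_n$ infer $\Gamma,\Box A_1,\dots,\Box A_n\Rightarrow\Box B,\Delta$; ($\mathsf{M}n$): from $A_1,\dots,A_n\Rightarrow B$ infer $\Gamma,\Box A_1,\dots,\Box A_n\Rightarrow\Box B,\Delta$. $\mathsf{G}_{\mathsf{E}\mathcal{A}}$ is $\mathsf{G}$ plus: for $\mathsf{E}$: (E); $\mathsf{EN}$: (E),(N); $\mathsf{EC}$: ($\mathsf{E}n$), $n\geq1$; $\mathsf{ECN}$: ($\mathsf{E}n$), $n\geq1$, and (N); $\mathsf{EM}$: (M); $\mathsf{EMN}$: (M),(N); $\mathsf{EMC}$: ($\mathsf{M}n$), $n\geq1$; $\mathsf{EMCN}$: ($\mathsf{M}n$), $n\geq0$. -}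

module Defs where

open import Data.Nat using (ℕ)
open import Data.Bool using (Bool; true; false; _∧_; _∨_; not)
open import Data.List using (List; []; _∷_; [_]; map)
open import Data.List.Relation.Unary.All using (All)
open import Data.List.Relation.Binary.Permutation.Propositional using (_↭_)
open import Data.Product using (_×_; _,_)
open import Relation.Binary.PropositionalEquality using (_≡_)

infixr 6 _∧ᶠ_
infixr 5 _∨ᶠ_
infixr 4 _⊃_
infix 8 □_ ¬ᶠ_

data Fm : Set where
  var   : ℕ → Fm
  bot   : Fm
  top   : Fm
  ¬ᶠ_   : Fm → Fm
  _∧ᶠ_  : Fm → Fm → Fm
  _∨ᶠ_  : Fm → Fm → Fm
  _⊃_   : Fm → Fm → Fm
  □_    : Fm → Fm

-- Finite multisets are represented by lists; multiset identity is
-- taken into account by explicit permutation (exchange) rules below.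
Seq : Set
Seq = List Fm × List Fm      -- (Γ , Δ) stands for Γ ⇒ Δ

record Axioms : Set where
  constructor axioms
  field
    hasN : Bool
    hasM : Bool
    hasC : Bool
open Axioms public

-- Classical evaluation; atoms and boxed formulas get arbitrary values
-- (so tautologies are substitution instances of propositional ones).
eval : (Fm → Bool) → Fm → Bool
eval w (var p)  = w (var p)
eval w bot      = false
eval w top      = true
eval w (¬ᶠ a)   = not (eval w a)
eval w (a ∧ᶠ b) = eval w a ∧ eval w b
eval w (a ∨ᶠ b) = eval w a ∨ eval w b
eval w (a ⊃ b)  = not (eval w a) ∨ eval w b
eval w (□ a)    = w (□ a)

Taut : Fm → Set
Taut a = ∀ (w : Fm → Bool) → eval w a ≡ true

data Thm (𝒜 : Axioms) : Fm → Set where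
  taut  : ∀ {a} → Taut a → Thm 𝒜 a
  axM   : ∀ {a b} → hasM 𝒜 ≡ true → Thm 𝒜 (□ (a ∧ᶠ b) ⊃ (□ a ∧ᶠ □ b))
  axC   : ∀ {a b} → hasC 𝒜 ≡ true → Thm 𝒜 ((□ a ∧ᶠ □ b) ⊃ □ (a ∧ᶠ b))
  axN   : hasN 𝒜 ≡ true → Thm 𝒜 (□ top)
  mp    : ∀ {a b} → Thm 𝒜 (a ⊃ b) → Thm 𝒜 a → Thm 𝒜 b
  ruleE : ∀ {a b} → Thm 𝒜 (a ⊃ b) → Thm 𝒜 (b ⊃ a) → Thm 𝒜 (□ a ⊃ □ b)

-- Propositional rules (principal formulas written first; contexts Γ, Δ)
-- PropRule premisses conclusion

data PropRule : List Seq → Seq → Set where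
  init : ∀ {Γ Δ p} → PropRule [] (var p ∷ Γ , var p ∷ Δ)
  botL : ∀ {Γ Δ} → PropRule [] (bot ∷ Γ , Δ)
  topR : ∀ {Γ Δ} → PropRule [] (Γ , top ∷ Δ)
  negL : ∀ {Γ Δ a} → PropRule [ (Γ , a ∷ Δ) ] ((¬ᶠ a) ∷ Γ , Δ)
  negR : ∀ {Γ Δ a} → PropRule [ (a ∷ Γ , Δ) ] (Γ , (¬ᶠ a) ∷ Δ)
  andL : ∀ {Γ Δ a b} → PropRule [ (a ∷ b ∷ Γ , Δ) ] ((a ∧ᶠ b) ∷ Γ , Δ)
  andR : ∀ {Γ Δ a b} →
         PropRule ((Γ , a ∷ Δ) ∷ (Γ , b ∷ Δ) ∷ []) (Γ , (a ∧ᶠ b) ∷ Δ)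
  orL  : ∀ {Γ Δ a b} →
         PropRule ((a ∷ Γ , Δ) ∷ (b ∷ Γ , Δ) ∷ []) ((a ∨ᶠ b) ∷ Γ , Δ)
  orR  : ∀ {Γ Δ a b} → PropRule [ (Γ , a ∷ b ∷ Δ) ] (Γ , (a ∨ᶠ b) ∷ Δ)
  impL : ∀ {Γ Δ a b} →
         PropRule ((Γ , a ∷ Δ) ∷ (b ∷ Γ , Δ) ∷ []) ((a ⊃ b) ∷ Γ , Δ)
  impR : ∀ {Γ Δ a b} → PropRule [ (a ∷ Γ , b ∷ Δ) ] (Γ , (a ⊃ b) ∷ Δ)

data ContrRule : Seq → Seq → Set where
  conL : ∀ {Γ Δ a} → ContrRule (a ∷ a ∷ Γ , Δ) (a ∷ Γ , Δ)
  conR : ∀ {Γ Δ a} → ContrRule (Γ , a ∷ a ∷ Δ) (Γ , a ∷ Δ)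

data WeakRule : Seq → Seq → Set where
  wkL : ∀ {Γ Δ a} → WeakRule (Γ , Δ) (a ∷ Γ , Δ)
  wkR : ∀ {Γ Δ a} → WeakRule (Γ , Δ) (Γ , a ∷ Δ)

_≈S_ : Seq → Seq → Set
(Γ , Δ) ≈S (Γ' , Δ') = (Γ ↭ Γ') × (Δ ↭ Δ')

data GDer (𝒜 : Axioms) : Seq → Set where
  perm  : ∀ {s t} → s ≈S t → GDer 𝒜 t → GDer 𝒜 s
  prop  : ∀ {ps c} → PropRule ps c → All (GDer 𝒜) ps → GDer 𝒜 c
  contr : ∀ {p c} → ContrRule p c → GDer 𝒜 p → GDer 𝒜 c
  ruleE : ∀ {Γ Δ a b} → hasM 𝒜 ≡ false → hasC 𝒜 ≡ false →
          GDer 𝒜 ([ a ] , [ b ]) → GDer 𝒜 ([ b ] , [ a ]) →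
          GDer 𝒜 ((□ a) ∷ Γ , (□ b) ∷ Δ)
  ruleEn : ∀ {Γ Δ a as b} → hasM 𝒜 ≡ false → hasC 𝒜 ≡ true →
           GDer 𝒜 (a ∷ as , [ b ]) →
           All (λ c → GDer 𝒜 ([ b ] , [ c ])) (a ∷ as) →
           GDer 𝒜 (map □_ (a ∷ as) Data.List.++ Γ , (□ b) ∷ Δ)
  ruleM : ∀ {Γ Δ a b} → hasM 𝒜 ≡ true → hasC 𝒜 ≡ false →
          GDer 𝒜 ([ a ] , [ b ]) →
          GDer 𝒜 ((□ a) ∷ Γ , (□ b) ∷ Δ)
  ruleMn : ∀ {Γ Δ a as b} → hasM 𝒜 ≡ true → hasC 𝒜 ≡ true →
           GDer 𝒜 (a ∷ as , [ b ]) →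
           GDer 𝒜 (map □_ (a ∷ as) Data.List.++ Γ , (□ b) ∷ Δ)
  -- (N): if N ∈ 𝒜 (for EMCN this is exactly the n = 0 instance of (Mn))
  ruleN : ∀ {Γ Δ b} → hasN 𝒜 ≡ true →
          GDer 𝒜 ([] , [ b ]) →
          GDer 𝒜 (Γ , (□ b) ∷ Δ)

-- X ::= Γ⇒Δ | Γ⇒Δ /ₑ (Σ⇒Π ; Ω⇒Θ) | Γ⇒Δ / X
data LNS : Set where
  last  : Seq → LNS
  lastE : Seq → Seq → Seq → LNS
  _/_   : Seq → LNS → LNS

infixr 4 _/_

plug : List Seq → LNS → LNS
plug []      X = X
plug (s ∷ G) X = s / plug G X

-- Contexts 𝒮{ } with the hole at an ordinary component
-- (never a sequent inside /ₑ).
data Tail : Set where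
  none : Tail
  nest : LNS → Tail
  ee   : Seq → Seq → Tail

record Ctx : Set where
  constructor ctx
  field
    prefix : List Seq
    tail   : Tail

fillTail : Tail → Seq → LNS
fillTail none     s = last s
fillTail (nest X) s = s / X
fillTail (ee a b) s = lastE s a b

fill : Ctx → Seq → LNS
fill (ctx G t) s = plug G (fillTail t s)

data _≈L_ : LNS → LNS → Set where
  lastP  : ∀ {s t} → s ≈S t → last s ≈L last t
  lastEP : ∀ {s t a a' b b'} → s ≈S t → a ≈S a' → b ≈S b' →
           lastE s a b ≈L lastE t a' b'
  consP  : ∀ {s t X Y} → s ≈S t → X ≈L Y → (s / X) ≈L (t / Y)

-- LNS_{E𝒜} extended with contraction, and (if W = true) weakening.
data LDer (𝒜 : Axioms) (W : Bool) : LNS → Set where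
  perm  : ∀ {X Y} → X ≈L Y → LDer 𝒜 W Y → LDer 𝒜 W X
  prop  : ∀ {ps c} (S : Ctx) → PropRule ps c →
          All (λ p → LDer 𝒜 W (fill S p)) ps → LDer 𝒜 W (fill S c)
  contr : ∀ {p c} (S : Ctx) → ContrRule p c →
          LDer 𝒜 W (fill S p) → LDer 𝒜 W (fill S c)
  weak  : ∀ {p c} (S : Ctx) → W ≡ true → WeakRule p c →
          LDer 𝒜 W (fill S p) → LDer 𝒜 W (fill S c)
  boxR  : ∀ {G Γ Δ b} →
          LDer 𝒜 W (plug G (lastE (Γ , Δ) ([] , [ b ]) ([ b ] , []))) →
          LDer 𝒜 W (plug G (last (Γ , (□ b) ∷ Δ)))
  boxL  : ∀ {G Γ Δ Σ Π Ω Θ a} →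
          LDer 𝒜 W (plug G ((Γ , Δ) / last (a ∷ Σ , Π))) →
          LDer 𝒜 W (plug G ((Γ , Δ) / last (Ω , a ∷ Θ))) →
          LDer 𝒜 W (plug G (lastE ((□ a) ∷ Γ , Δ) (Σ , Π) (Ω , Θ)))
  ruleN : ∀ {G Γ Δ b} → hasN 𝒜 ≡ true →
          LDer 𝒜 W (plug G ((Γ , Δ) / last ([] , [ b ]))) →
          LDer 𝒜 W (plug G (last (Γ , (□ b) ∷ Δ)))
  ruleM : ∀ {G Γ Δ Σ Π Ω Θ} → hasM 𝒜 ≡ true →
          LDer 𝒜 W (plug G (lastE (Γ , Δ) (Σ , Π) (bot ∷ Ω , Θ))) →
          LDer 𝒜 W (plug G (lastE (Γ , Δ) (Σ , Π) (Ω , Θ)))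
  ruleC : ∀ {G Γ Δ Σ Π Ω Θ a} → hasC 𝒜 ≡ true →
          LDer 𝒜 W (plug G (lastE (Γ , Δ) (a ∷ Σ , Π) (Ω , Θ))) →
          LDer 𝒜 W (plug G ((Γ , Δ) / last (Ω , a ∷ Θ))) →
          LDer 𝒜 W (plug G (lastE ((□ a) ∷ Γ , Δ) (Σ , Π) (Ω , Θ)))

module Submission where

-- Read a linear nested sequent in G_{E𝒜} component by component: a plain component Γ ⇒ Δ as
-- itself, and a component Γ ⇒ Δ /ₑ (Σ ⇒ Π ; Ω ⇒ Θ), whose block was opened by □R on some □b, as
-- the sequent □Σ, Γ ⇒ □b, Δ that the modal rule of G_{E𝒜} derives once □L closes the block; a
-- structure holds when one of its components does. Every rule of LNS_{E𝒜} preserves this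
-- reading (□L and the C-rule supply exactly the premisses of (E), (M), (En) or (Mn)), so a
-- derivable one-component structure is derivable in G_{E𝒜}. Finally G_{E𝒜} is sound for E𝒜
-- under Γ ⇒ Δ ↦ ⋀Γ → ⋁Δ, because E𝒜 is closed under tautological consequence.

open import Level using (0ℓ)
open import Data.Bool using (Bool; true; false; T; not; _∨_)
open import Data.Bool.Properties using (T-≡; T-∧; T-∨)
open import Data.Empty using (⊥; ⊥-elim)
open import Data.List using (List; []; _∷_; [_]; _++_; map)
open import Data.List.Properties using (++-assoc)
open import Data.List.Relation.Unary.All as All using (All; []; _∷_)
open import Data.List.Relation.Unary.All.Properties using (map⁺; map⁻; ++⁻ˡ)
open import Data.List.Relation.Unary.Any.Properties using (singleton⁻)
open import Data.List.Relation.Unary.Any using (Any; here; there)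
open import Data.List.Relation.Binary.Permutation.Propositional
  using (_↭_; ↭-refl; ↭-sym; ↭-trans; ↭-reflexive; prep)
open import Data.List.Relation.Binary.Permutation.Propositional.Properties
  using (All-resp-↭; Any-resp-↭; ++-comm; ++⁺; ++⁺ʳ; ++-identityʳ; shift)
import Data.List.Relation.Binary.Permutation.Propositional.Properties as ↭
open import Data.Product as Product using (_×_; _,_; proj₁; proj₂)
open import Data.Sum as Sum using (_⊎_; inj₁; inj₂)
import Data.Sum.Effectful.Left as Sumₗ
import Data.Sum.Effectful.Right as Sumᵣ
open import Function using (_∘_; id; Equivalence)
open import Relation.Binary.PropositionalEquality using (_≡_; refl)

open import Defs

open Equivalence using (to; from)

variable
  𝒜 : Axioms
  W : Bool
  a b : Fm
  Γ Δ Γ′ Σ Π Ω Θ : List Fm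
  s t σ σ′ ω ω′ : Seq
  ps : List Seq
  X Y Z : LNS

-- Weakening in G_{E𝒜}

-- Contexts are appended at the end, where every rule schema of Defs keeps its context, so an
-- extended rule instance is again an instance of the same rule.
_++ˢ_ : Seq → Seq → Seq
(Γ , Δ) ++ˢ (Γ′ , Δ′) = (Γ ++ Γ′ , Δ ++ Δ′)

PropRule-++ˢ : ∀ e → PropRule ps s → PropRule (map (_++ˢ e) ps) (s ++ˢ e)
PropRule-++ˢ e init = init
PropRule-++ˢ e botL = botL
PropRule-++ˢ e topR = topR
PropRule-++ˢ e negL = negL
PropRule-++ˢ e negR = negR
PropRule-++ˢ e andL = andL
PropRule-++ˢ e andR = andR
PropRule-++ˢ e orL  = orL
PropRule-++ˢ e orR  = orR
PropRule-++ˢ e impL = impL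
PropRule-++ˢ e impR = impR

ContrRule-++ˢ : ∀ e → ContrRule t s → ContrRule (t ++ˢ e) (s ++ˢ e)
ContrRule-++ˢ e conL = conL
ContrRule-++ˢ e conR = conR

WeakRule-++ˢ : ∀ e → WeakRule t s → WeakRule (t ++ˢ e) (s ++ˢ e)
WeakRule-++ˢ e wkL = wkL
WeakRule-++ˢ e wkR = wkR

mutual
  weaken : ∀ e → GDer 𝒜 s → GDer 𝒜 (s ++ˢ e)
  weaken e (perm (p , q) d)     = perm (++⁺ʳ _ p , ++⁺ʳ _ q) (weaken e d)
  weaken e (prop r ds)          = prop (PropRule-++ˢ e r) (map⁺ (weaken-All e ds))
  weaken e (contr r d)          = contr (ContrRule-++ˢ e r) (weaken e d)
  weaken e (ruleE hM hC d₁ d₂)  = ruleE hM hC d₁ d₂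
  weaken e (ruleEn {a = a} {as} hM hC d ds) =
    perm (↭-reflexive (++-assoc (map □_ (a ∷ as)) _ _) , ↭-refl) (ruleEn hM hC d ds)
  weaken e (ruleM hM hC d)      = ruleM hM hC d
  weaken e (ruleMn {a = a} {as} hM hC d) =
    perm (↭-reflexive (++-assoc (map □_ (a ∷ as)) _ _) , ↭-refl) (ruleMn hM hC d)
  weaken e (ruleN hN d)         = ruleN hN d

  weaken-All : ∀ e → All (GDer 𝒜) ps → All (GDer 𝒜 ∘ (_++ˢ e)) ps
  weaken-All e []       = []
  weaken-All e (d ∷ ds) = weaken e d ∷ weaken-All e ds

WeakRule-admissible : WeakRule t s → GDer 𝒜 t → GDer 𝒜 s
WeakRule-admissible (wkL {Γ} {Δ} {a}) d =
  perm (↭-sym (++-comm Γ [ a ]) , ↭-sym (++-identityʳ Δ)) (weaken ([ a ] , []) d)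
WeakRule-admissible (wkR {Γ} {Δ} {a}) d =
  perm (↭-sym (++-identityʳ Γ) , ++-comm [ a ] Δ) (weaken ([] , [ a ]) d)

data LocalRule : List Seq → Seq → Set where
  prop  : PropRule ps s → LocalRule ps s
  contr : ContrRule t s → LocalRule [ t ] s
  weak  : WeakRule t s → LocalRule [ t ] s

LocalRule-++ˢ : ∀ e → LocalRule ps s → LocalRule (map (_++ˢ e) ps) (s ++ˢ e)
LocalRule-++ˢ e (prop r)  = prop (PropRule-++ˢ e r)
LocalRule-++ˢ e (contr r) = contr (ContrRule-++ˢ e r)
LocalRule-++ˢ e (weak r)  = weak (WeakRule-++ˢ e r)

LocalRule-admissible : LocalRule ps s → All (GDer 𝒜) ps → GDer 𝒜 s
LocalRule-admissible (prop r)  ds       = prop r ds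
LocalRule-admissible (contr r) (d ∷ []) = contr r d
LocalRule-admissible (weak r)  (d ∷ []) = WeakRule-admissible r d

-- Linear nested sequents read in G_{E𝒜}

-- What the block (⇒ b ; b ⇒) created by □R becomes: only the C-rule adds to Σ and only the
-- M-rule adds to Ω (a ⊥); without M each added formula c comes with a derivation of b ⇒ c,
-- the extra premiss of (En).
data BoxBlock (𝒜 : Axioms) (b : Fm) : Seq → Seq → Set where
  block : Π ↭ [ b ] → Θ ↭ [] →
          (hasM 𝒜 ≡ false → Ω ↭ [ b ]) →
          (hasC 𝒜 ≡ false → Σ ↭ []) →
          (hasM 𝒜 ≡ false → All (λ a → GDer 𝒜 ([ b ] , [ a ])) Σ) →
          BoxBlock 𝒜 b (Σ , Π) (Ω , Θ)

_⊢ᴳ_ : Axioms → LNS → Set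
𝒜 ⊢ᴳ last s             = GDer 𝒜 s
𝒜 ⊢ᴳ lastE s (Σ , Π) ω  = ∀ b → BoxBlock 𝒜 b (Σ , Π) ω → GDer 𝒜 (s ++ˢ (map □_ Σ , [ □ b ]))
𝒜 ⊢ᴳ (s / X)            = GDer 𝒜 s ⊎ 𝒜 ⊢ᴳ X

BoxBlock-resp-≈S : σ ≈S σ′ → ω ≈S ω′ → BoxBlock 𝒜 b σ ω → BoxBlock 𝒜 b σ′ ω′
BoxBlock-resp-≈S (pΣ , pΠ) (pΩ , pΘ) (block Π≈ Θ≈ Ω≈ Σ≈ Σ⊢) =
  block (↭-trans (↭-sym pΠ) Π≈) (↭-trans (↭-sym pΘ) Θ≈) (↭-trans (↭-sym pΩ) ∘ Ω≈)
        (↭-trans (↭-sym pΣ) ∘ Σ≈) (All-resp-↭ pΣ ∘ Σ⊢)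

⊢ᴳ-resp-≈L : X ≈L Y → 𝒜 ⊢ᴳ Y → 𝒜 ⊢ᴳ X
⊢ᴳ-resp-≈L (lastP s≈t)     = perm s≈t
⊢ᴳ-resp-≈L (consP s≈t X≈Y) = Sum.map (perm s≈t) (⊢ᴳ-resp-≈L X≈Y)
⊢ᴳ-resp-≈L (lastEP (pΓ , pΔ) σ≈σ′ ω≈ω′) h b blk =
  perm (++⁺ pΓ (↭.map⁺ □_ (proj₁ σ≈σ′)) , ++⁺ʳ _ pΔ) (h b (BoxBlock-resp-≈S σ≈σ′ ω≈ω′ blk))

⊢ᴳ-weaken : GDer 𝒜 (Γ , Δ) → 𝒜 ⊢ᴳ lastE (a ∷ Γ , Δ) σ ω
⊢ᴳ-weaken d _ _ = weaken _ (WeakRule-admissible wkL d)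

⊢ᴳ-fillTail : ∀ t → LocalRule ps s → All (λ p → 𝒜 ⊢ᴳ fillTail t p) ps → 𝒜 ⊢ᴳ fillTail t s
⊢ᴳ-fillTail none     r ds = LocalRule-admissible r ds
⊢ᴳ-fillTail {𝒜 = 𝒜} (nest X) r ds =
  Sum.map₁ (LocalRule-admissible r) (All.sequenceA 0ℓ (Sumᵣ.applicative 0ℓ (𝒜 ⊢ᴳ X)) ds)
⊢ᴳ-fillTail (ee σ ω) r hs b blk =
  LocalRule-admissible (LocalRule-++ˢ _ r) (map⁺ (All.map (λ h → h b blk) hs))

⊢ᴳ-plug : ∀ G {I : Set} {is : List I} (f : I → LNS) →
          (All (λ i → 𝒜 ⊢ᴳ f i) is → 𝒜 ⊢ᴳ Z) →
          All (λ i → 𝒜 ⊢ᴳ plug G (f i)) is → 𝒜 ⊢ᴳ plug G Z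
⊢ᴳ-plug []      f h = h
⊢ᴳ-plug {𝒜 = 𝒜} (s ∷ G) f h =
  Sum.map₂ (⊢ᴳ-plug G f h) ∘ All.sequenceA 0ℓ (Sumₗ.applicative (GDer 𝒜 s) 0ℓ)

⊢ᴳ-plug₁ : ∀ G → (𝒜 ⊢ᴳ Y → 𝒜 ⊢ᴳ Z) → 𝒜 ⊢ᴳ plug G Y → 𝒜 ⊢ᴳ plug G Z
⊢ᴳ-plug₁ G h d = ⊢ᴳ-plug G id (λ { (e ∷ []) → h e }) (d ∷ [])

⊢ᴳ-plug₂ : ∀ G → (𝒜 ⊢ᴳ X → 𝒜 ⊢ᴳ Y → 𝒜 ⊢ᴳ Z) →
           𝒜 ⊢ᴳ plug G X → 𝒜 ⊢ᴳ plug G Y → 𝒜 ⊢ᴳ plug G Z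
⊢ᴳ-plug₂ G h d₁ d₂ = ⊢ᴳ-plug G id (λ { (e₁ ∷ e₂ ∷ []) → h e₁ e₂ }) (d₁ ∷ d₂ ∷ [])

⊢ᴳ-boxR : 𝒜 ⊢ᴳ lastE (Γ , Δ) ([] , [ b ]) ([ b ] , []) → GDer 𝒜 (Γ , □ b ∷ Δ)
⊢ᴳ-boxR {Γ = Γ} {Δ = Δ} {b = b} h =
  perm (↭-sym (++-identityʳ Γ) , ++-comm [ □ b ] Δ)
       (h b (block ↭-refl ↭-refl (λ _ → ↭-refl) (λ _ → ↭-refl) (λ _ → [])))

boxL-admissible : GDer 𝒜 (a ∷ Σ , Π) → GDer 𝒜 (Ω , a ∷ Θ) → BoxBlock 𝒜 b (Σ , Π) (Ω , Θ) →
                  GDer 𝒜 (map □_ Σ ++ □ a ∷ Γ , □ b ∷ Δ)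
boxL-admissible {𝒜 = axioms _ false false} {a = a} {Γ = Γ} d₁ d₂ (block Π≈ Θ≈ Ω≈ Σ≈ _) =
  perm (++⁺ʳ (□ a ∷ Γ) (↭.map⁺ □_ (Σ≈ refl)) , ↭-refl)
       (ruleE refl refl (perm (prep a (↭-sym (Σ≈ refl)) , ↭-sym Π≈) d₁)
                        (perm (↭-sym (Ω≈ refl) , prep a (↭-sym Θ≈)) d₂))
boxL-admissible {𝒜 = axioms _ true false} {a = a} {Γ = Γ} d₁ _ (block Π≈ _ _ Σ≈ _) =
  perm (++⁺ʳ (□ a ∷ Γ) (↭.map⁺ □_ (Σ≈ refl)) , ↭-refl)
       (ruleM refl refl (perm (prep a (↭-sym (Σ≈ refl)) , ↭-sym Π≈) d₁))
boxL-admissible {𝒜 = axioms _ false true} {a = a} {Σ = Σ} {Γ = Γ} d₁ d₂ (block Π≈ Θ≈ Ω≈ _ Σ⊢) =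
  perm (shift (□ a) (map □_ Σ) Γ , ↭-refl)
       (ruleEn refl refl (perm (↭-refl , ↭-sym Π≈) d₁)
                         (perm (↭-sym (Ω≈ refl) , prep a (↭-sym Θ≈)) d₂ ∷ Σ⊢ refl))
boxL-admissible {𝒜 = axioms _ true true} {a = a} {Σ = Σ} {Γ = Γ} d₁ _ (block Π≈ _ _ _ _) =
  perm (shift (□ a) (map □_ Σ) Γ , ↭-refl) (ruleMn refl refl (perm (↭-refl , ↭-sym Π≈) d₁))

⊢ᴳ-boxL : 𝒜 ⊢ᴳ ((Γ , Δ) / last (a ∷ Σ , Π)) → 𝒜 ⊢ᴳ ((Γ , Δ) / last (Ω , a ∷ Θ)) →
          𝒜 ⊢ᴳ lastE (□ a ∷ Γ , Δ) (Σ , Π) (Ω , Θ)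
⊢ᴳ-boxL (inj₁ d)  _         = ⊢ᴳ-weaken d
⊢ᴳ-boxL (inj₂ _)  (inj₁ d)  = ⊢ᴳ-weaken d
⊢ᴳ-boxL {Γ = Γ} {Δ = Δ} {a = a} {Σ = Σ} (inj₂ d₁) (inj₂ d₂) b blk =
  perm (++-comm (□ a ∷ Γ) (map □_ Σ) , ++-comm Δ [ □ b ]) (boxL-admissible d₁ d₂ blk)

⊢ᴳ-ruleC : hasC 𝒜 ≡ true → 𝒜 ⊢ᴳ lastE (Γ , Δ) (a ∷ Σ , Π) (Ω , Θ) →
           𝒜 ⊢ᴳ ((Γ , Δ) / last (Ω , a ∷ Θ)) → 𝒜 ⊢ᴳ lastE (□ a ∷ Γ , Δ) (Σ , Π) (Ω , Θ)
⊢ᴳ-ruleC _ _ (inj₁ d) = ⊢ᴳ-weaken d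
⊢ᴳ-ruleC {𝒜 = axioms _ _ true} {Γ = Γ} {a = a} {Σ = Σ} refl h (inj₂ d) b (block Π≈ Θ≈ Ω≈ _ Σ⊢) =
  perm (↭-sym (shift (□ a) Γ (map □_ Σ)) , ↭-refl)
       (h b (block Π≈ Θ≈ Ω≈ (λ ()) λ m≡f → perm (↭-sym (Ω≈ m≡f) , prep a (↭-sym Θ≈)) d ∷ Σ⊢ m≡f))

⊢ᴳ-ruleM : hasM 𝒜 ≡ true → 𝒜 ⊢ᴳ lastE s σ (bot ∷ Ω , Θ) → 𝒜 ⊢ᴳ lastE s σ (Ω , Θ)
⊢ᴳ-ruleM {𝒜 = axioms _ true _} refl h b (block Π≈ Θ≈ _ Σ≈ Σ⊢) = h b (block Π≈ Θ≈ (λ ()) Σ≈ Σ⊢)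

⊢ᴳ-ruleN : hasN 𝒜 ≡ true → 𝒜 ⊢ᴳ ((Γ , Δ) / last ([] , [ b ])) → GDer 𝒜 (Γ , □ b ∷ Δ)
⊢ᴳ-ruleN _  (inj₁ d) = WeakRule-admissible wkR d
⊢ᴳ-ruleN hN (inj₂ d) = ruleN hN d

mutual
  LDer⇒⊢ᴳ : LDer 𝒜 W X → 𝒜 ⊢ᴳ X
  LDer⇒⊢ᴳ (perm X≈Y d)            = ⊢ᴳ-resp-≈L X≈Y (LDer⇒⊢ᴳ d)
  LDer⇒⊢ᴳ (prop (ctx G t) r ds)   = ⊢ᴳ-plug G (fillTail t) (⊢ᴳ-fillTail t (prop r)) (LDer⇒⊢ᴳ-All ds)
  LDer⇒⊢ᴳ (contr (ctx G t) r d)   = ⊢ᴳ-plug₁ G (⊢ᴳ-fillTail t (contr r) ∘ (_∷ [])) (LDer⇒⊢ᴳ d)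
  LDer⇒⊢ᴳ (weak (ctx G t) _ r d)  = ⊢ᴳ-plug₁ G (⊢ᴳ-fillTail t (weak r) ∘ (_∷ [])) (LDer⇒⊢ᴳ d)
  LDer⇒⊢ᴳ (boxR {G} d)            = ⊢ᴳ-plug₁ G ⊢ᴳ-boxR (LDer⇒⊢ᴳ d)
  LDer⇒⊢ᴳ (boxL {G} d₁ d₂)        = ⊢ᴳ-plug₂ G ⊢ᴳ-boxL (LDer⇒⊢ᴳ d₁) (LDer⇒⊢ᴳ d₂)
  LDer⇒⊢ᴳ (ruleN {G} hN d)        = ⊢ᴳ-plug₁ G (⊢ᴳ-ruleN hN) (LDer⇒⊢ᴳ d)
  LDer⇒⊢ᴳ (ruleM {G} hM d)        = ⊢ᴳ-plug₁ G (⊢ᴳ-ruleM hM) (LDer⇒⊢ᴳ d)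
  LDer⇒⊢ᴳ (ruleC {G} hC d₁ d₂)    = ⊢ᴳ-plug₂ G (⊢ᴳ-ruleC hC) (LDer⇒⊢ᴳ d₁) (LDer⇒⊢ᴳ d₂)

  LDer⇒⊢ᴳ-All : ∀ {f : Seq → LNS} → All (LDer 𝒜 W ∘ f) ps → All (λ p → 𝒜 ⊢ᴳ f p) ps
  LDer⇒⊢ᴳ-All []       = []
  LDer⇒⊢ᴳ-All (d ∷ ds) = LDer⇒⊢ᴳ d ∷ LDer⇒⊢ᴳ-All ds

-- Soundness of G_{E𝒜} for E𝒜

T-em : ∀ x → T x ⊎ T (not x)
T-em true  = inj₁ _
T-em false = inj₂ _

T-¬⁻ : ∀ {x} → T (not x) → T x → ⊥
T-¬⁻ {true} ()

T-⊃⁺ : ∀ {x y} → (T x → T y) → T (not x ∨ y)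
T-⊃⁺ {true}  f = f _
T-⊃⁺ {false} f = _

T-⊃⁻ : ∀ {x y} → T (not x ∨ y) → T x → T y
T-⊃⁻ {true} p _ = p

-- A record, so that w and the formula can be read off a goal w ⊩ a.
record _⊩_ (w : Fm → Bool) (a : Fm) : Set where
  constructor ⟨_⟩
  field ⊩⇒T : T (eval w a)
open _⊩_

_⊨_ : (Fm → Bool) → Seq → Set
w ⊨ (Γ , Δ) = All (w ⊩_) Γ → Any (w ⊩_) Δ

⋀ : List Fm → Fm
⋀ []      = top
⋀ (a ∷ Γ) = a ∧ᶠ ⋀ Γ

⋁ : List Fm → Fm
⋁ []      = bot
⋁ (a ∷ Δ) = a ∨ᶠ ⋁ Δ

⌜_⌝ : Seq → Fm
⌜ Γ , Δ ⌝ = ⋀ Γ ⊃ ⋁ Δ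

_⊢ᴴ_ : Axioms → Seq → Set
𝒜 ⊢ᴴ s = Thm 𝒜 ⌜ s ⌝

module _ {w : Fm → Bool} where

  ⊩-top : w ⊩ top
  ⊩-top = ⟨ _ ⟩

  ⊩-bot : w ⊩ bot → ⊥
  ⊩-bot ⟨ () ⟩

  ⊩-em : w ⊩ a ⊎ w ⊩ (¬ᶠ a)
  ⊩-em {a = a} = Sum.map ⟨_⟩ ⟨_⟩ (T-em (eval w a))

  ⊩-¬⁻ : w ⊩ (¬ᶠ a) → w ⊩ a → ⊥
  ⊩-¬⁻ ⟨ p ⟩ ⟨ q ⟩ = T-¬⁻ p q

  ⊩-∧⁺ : w ⊩ a → w ⊩ b → w ⊩ (a ∧ᶠ b)
  ⊩-∧⁺ ⟨ p ⟩ ⟨ q ⟩ = ⟨ from T-∧ (p , q) ⟩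

  ⊩-∧⁻ : w ⊩ (a ∧ᶠ b) → w ⊩ a × w ⊩ b
  ⊩-∧⁻ {a = a} ⟨ p ⟩ = Product.map ⟨_⟩ ⟨_⟩ (to (T-∧ {eval w a}) p)

  ⊩-∨⁺ : w ⊩ a ⊎ w ⊩ b → w ⊩ (a ∨ᶠ b)
  ⊩-∨⁺ = ⟨_⟩ ∘ from T-∨ ∘ Sum.map ⊩⇒T ⊩⇒T

  ⊩-∨⁻ : w ⊩ (a ∨ᶠ b) → w ⊩ a ⊎ w ⊩ b
  ⊩-∨⁻ {a = a} ⟨ p ⟩ = Sum.map ⟨_⟩ ⟨_⟩ (to (T-∨ {eval w a}) p)

  ⊩-⊃⁺ : (w ⊩ a → w ⊩ b) → w ⊩ (a ⊃ b)
  ⊩-⊃⁺ {a = a} f = ⟨ T-⊃⁺ {eval w a} (⊩⇒T ∘ f ∘ ⟨_⟩) ⟩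

  ⊩-⊃⁻ : w ⊩ (a ⊃ b) → w ⊩ a → w ⊩ b
  ⊩-⊃⁻ {a = a} ⟨ p ⟩ ⟨ q ⟩ = ⟨ T-⊃⁻ {eval w a} p q ⟩

  ⊩-⋀⁺ : All (w ⊩_) Γ → w ⊩ ⋀ Γ
  ⊩-⋀⁺ []       = ⊩-top
  ⊩-⋀⁺ (p ∷ ps) = ⊩-∧⁺ p (⊩-⋀⁺ ps)

  ⊩-⋀⁻ : w ⊩ ⋀ Γ → All (w ⊩_) Γ
  ⊩-⋀⁻ {Γ = []}    _ = []
  ⊩-⋀⁻ {Γ = a ∷ Γ} p = proj₁ (⊩-∧⁻ p) ∷ ⊩-⋀⁻ (proj₂ (⊩-∧⁻ p))

  ⊩-⋁⁺ : Any (w ⊩_) Δ → w ⊩ ⋁ Δ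
  ⊩-⋁⁺ (here p)  = ⊩-∨⁺ (inj₁ p)
  ⊩-⋁⁺ (there q) = ⊩-∨⁺ (inj₂ (⊩-⋁⁺ q))

  ⊩-⋁⁻ : w ⊩ ⋁ Δ → Any (w ⊩_) Δ
  ⊩-⋁⁻ {Δ = []}    p = ⊥-elim (⊩-bot p)
  ⊩-⋁⁻ {Δ = a ∷ Δ} p = Sum.[ here , there ∘ ⊩-⋁⁻ ]′ (⊩-∨⁻ p)

  ⊨⇒⊩⌜⌝ : w ⊨ s → w ⊩ ⌜ s ⌝
  ⊨⇒⊩⌜⌝ h = ⊩-⊃⁺ (⊩-⋁⁺ ∘ h ∘ ⊩-⋀⁻)

  ⊩⌜⌝⇒⊨ : w ⊩ ⌜ s ⌝ → w ⊨ s
  ⊩⌜⌝⇒⊨ p = ⊩-⋁⁻ ∘ ⊩-⊃⁻ p ∘ ⊩-⋀⁺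

  PropRule-⊨ : PropRule ps s → All (w ⊨_) ps → w ⊨ s
  PropRule-⊨ init [] (p ∷ _) = here p
  PropRule-⊨ botL [] (p ∷ _) = ⊥-elim (⊩-bot p)
  PropRule-⊨ topR [] _ = here ⊩-top
  PropRule-⊨ negL (h ∷ []) (p ∷ γ) with h γ
  ... | here q  = ⊥-elim (⊩-¬⁻ p q)
  ... | there δ = δ
  PropRule-⊨ negR (h ∷ []) γ with ⊩-em
  ... | inj₁ p  = there (h (p ∷ γ))
  ... | inj₂ ¬p = here ¬p
  PropRule-⊨ andL (h ∷ []) (p ∷ γ) = h (proj₁ (⊩-∧⁻ p) ∷ proj₂ (⊩-∧⁻ p) ∷ γ)
  PropRule-⊨ andR (h₁ ∷ h₂ ∷ []) γ with h₁ γ | h₂ γ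
  ... | here p  | here q  = here (⊩-∧⁺ p q)
  ... | there δ | _       = there δ
  ... | here _  | there δ = there δ
  PropRule-⊨ orL (h₁ ∷ h₂ ∷ []) (p ∷ γ) =
    Sum.[ (λ q → h₁ (q ∷ γ)) , (λ q → h₂ (q ∷ γ)) ]′ (⊩-∨⁻ p)
  PropRule-⊨ orR (h ∷ []) γ with h γ
  ... | here p          = here (⊩-∨⁺ (inj₁ p))
  ... | there (here p)  = here (⊩-∨⁺ (inj₂ p))
  ... | there (there δ) = there δ
  PropRule-⊨ impL (h₁ ∷ h₂ ∷ []) (p ∷ γ) with h₁ γ
  ... | here q  = h₂ (⊩-⊃⁻ p q ∷ γ)
  ... | there δ = δ
  PropRule-⊨ impR (h ∷ []) γ with ⊩-em
  ... | inj₂ ¬p = here (⊩-⊃⁺ (⊥-elim ∘ ⊩-¬⁻ ¬p))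
  ... | inj₁ p with h (p ∷ γ)
  ...   | here q  = here (⊩-⊃⁺ λ _ → q)
  ...   | there δ = there δ

  ContrRule-⊨ : ContrRule t s → w ⊨ t → w ⊨ s
  ContrRule-⊨ conL h (p ∷ γ) = h (p ∷ p ∷ γ)
  ContrRule-⊨ conR h γ with h γ
  ... | here p  = here p
  ... | there δ = δ

Thm-consequence : ∀ {fs f} → All (Thm 𝒜) fs → (∀ w → All (w ⊩_) fs → w ⊩ f) → Thm 𝒜 f
Thm-consequence []       h = taut λ w → to T-≡ (⊩⇒T (h w []))
Thm-consequence (d ∷ ds) h = mp (Thm-consequence ds λ w hs → ⊩-⊃⁺ λ p → h w (p ∷ hs)) d

Thm-consequence₁ : ∀ {f g} → Thm 𝒜 f → (∀ {w} → w ⊩ f → w ⊩ g) → Thm 𝒜 g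
Thm-consequence₁ d h = Thm-consequence (d ∷ []) λ { w (p ∷ []) → h p }

Thm-consequence₂ : ∀ {f g h} → Thm 𝒜 f → Thm 𝒜 g → (∀ {w} → w ⊩ f → w ⊩ g → w ⊩ h) → Thm 𝒜 h
Thm-consequence₂ d e h = Thm-consequence (d ∷ e ∷ []) λ { w (p ∷ q ∷ []) → h p q }

⊢ᴴ-consequence : All (𝒜 ⊢ᴴ_) ps → (∀ {w} → All (w ⊨_) ps → w ⊨ s) → 𝒜 ⊢ᴴ s
⊢ᴴ-consequence ds h = Thm-consequence (map⁺ ds) λ w hs → ⊨⇒⊩⌜⌝ (h (All.map ⊩⌜⌝⇒⊨ (map⁻ hs)))

Thm-⊃-trans : ∀ {f g h} → Thm 𝒜 (f ⊃ g) → Thm 𝒜 (g ⊃ h) → Thm 𝒜 (f ⊃ h)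
Thm-⊃-trans d e = Thm-consequence₂ d e λ p q → ⊩-⊃⁺ (⊩-⊃⁻ q ∘ ⊩-⊃⁻ p)

Thm-⊃-⋀ : ∀ {fs} → All (λ f → Thm 𝒜 (a ⊃ f)) fs → Thm 𝒜 (a ⊃ ⋀ fs)
Thm-⊃-⋀ ds = Thm-consequence (map⁺ ds) λ w hs →
  ⊩-⊃⁺ λ p → ⊩-⋀⁺ (All.map (λ q → ⊩-⊃⁻ q p) (map⁻ hs))

Thm-□-mono : hasM 𝒜 ≡ true → Thm 𝒜 (a ⊃ b) → Thm 𝒜 (□ a ⊃ □ b)
Thm-□-mono hM d = Thm-consequence₂ (ruleE a⊃a∧b a∧b⊃a) (axM hM) λ p q →
  ⊩-⊃⁺ (proj₂ ∘ ⊩-∧⁻ ∘ ⊩-⊃⁻ q ∘ ⊩-⊃⁻ p)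
  where
  a⊃a∧b = Thm-consequence₁ d λ p → ⊩-⊃⁺ λ q → ⊩-∧⁺ q (⊩-⊃⁻ p q)
  a∧b⊃a = Thm-consequence [] λ _ _ → ⊩-⊃⁺ (proj₁ ∘ ⊩-∧⁻)

Thm-□-nec : hasN 𝒜 ≡ true → Thm 𝒜 a → Thm 𝒜 (□ a)
Thm-□-nec hN d = mp (ruleE (Thm-consequence₁ d λ p → ⊩-⊃⁺ λ _ → p)
                           (Thm-consequence [] λ _ _ → ⊩-⊃⁺ λ _ → ⊩-top))
                    (axN hN)

Thm-□-⋀ : hasC 𝒜 ≡ true → ∀ a fs → Thm 𝒜 (⋀ (map □_ (a ∷ fs)) ⊃ □ ⋀ (a ∷ fs))
Thm-□-⋀ hC a [] = Thm-consequence₁ (ruleE a⊃a∧⊤ a∧⊤⊃a) λ p → ⊩-⊃⁺ (⊩-⊃⁻ p ∘ proj₁ ∘ ⊩-∧⁻)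
  where
  a⊃a∧⊤ = Thm-consequence [] λ _ _ → ⊩-⊃⁺ λ p → ⊩-∧⁺ p ⊩-top
  a∧⊤⊃a = Thm-consequence [] λ _ _ → ⊩-⊃⁺ (proj₁ ∘ ⊩-∧⁻)
Thm-□-⋀ hC a (f ∷ fs) = Thm-consequence₂ (Thm-□-⋀ hC f fs) (axC hC) λ p q →
  ⊩-⊃⁺ λ r → ⊩-⊃⁻ q (⊩-∧⁺ (proj₁ (⊩-∧⁻ r)) (⊩-⊃⁻ p (proj₂ (⊩-∧⁻ r))))

⊢ᴴ⇒Thm : 𝒜 ⊢ᴴ ([] , [ a ]) → Thm 𝒜 a
⊢ᴴ⇒Thm d = Thm-consequence₁ d λ p → singleton⁻ (⊩⌜⌝⇒⊨ p [])

⊢ᴴ⇒Thm-⊃ : 𝒜 ⊢ᴴ ([ a ] , [ b ]) → Thm 𝒜 (a ⊃ b)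
⊢ᴴ⇒Thm-⊃ d = Thm-consequence₁ d λ p → ⊩-⊃⁺ λ q → singleton⁻ (⊩⌜⌝⇒⊨ p (q ∷ []))

⊢ᴴ⇒Thm-⋀⊃ : 𝒜 ⊢ᴴ (Γ , [ b ]) → Thm 𝒜 (⋀ Γ ⊃ b)
⊢ᴴ⇒Thm-⋀⊃ d = Thm-consequence₁ d λ p → ⊩-⊃⁺ λ q → singleton⁻ (⊩⌜⌝⇒⊨ p (⊩-⋀⁻ q))

Thm⇒⊢ᴴ : Thm 𝒜 a → 𝒜 ⊢ᴴ (Γ , a ∷ Δ)
Thm⇒⊢ᴴ d = Thm-consequence₁ d λ p → ⊨⇒⊩⌜⌝ λ _ → here p

Thm-⊃⇒⊢ᴴ : Thm 𝒜 (a ⊃ b) → 𝒜 ⊢ᴴ (a ∷ Γ , b ∷ Δ)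
Thm-⊃⇒⊢ᴴ d = Thm-consequence₁ d λ p → ⊨⇒⊩⌜⌝ (here ∘ ⊩-⊃⁻ p ∘ All.head)

Thm-⋀⊃⇒⊢ᴴ : Thm 𝒜 (⋀ Γ′ ⊃ b) → 𝒜 ⊢ᴴ (Γ′ ++ Γ , b ∷ Δ)
Thm-⋀⊃⇒⊢ᴴ {Γ′ = Γ′} d = Thm-consequence₁ d λ p → ⊨⇒⊩⌜⌝ (here ∘ ⊩-⊃⁻ p ∘ ⊩-⋀⁺ ∘ ++⁻ˡ Γ′)

mutual
  GDer-sound : GDer 𝒜 s → 𝒜 ⊢ᴴ s
  GDer-sound (perm (p , q) d) = ⊢ᴴ-consequence (GDer-sound d ∷ []) λ { (h ∷ []) →
    Any-resp-↭ (↭-sym q) ∘ h ∘ All-resp-↭ p }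
  GDer-sound (prop r ds) = ⊢ᴴ-consequence (GDer-sound-All ds) (PropRule-⊨ r)
  GDer-sound (contr r d) = ⊢ᴴ-consequence (GDer-sound d ∷ []) λ { (h ∷ []) → ContrRule-⊨ r h }
  GDer-sound (ruleE _ _ d e) = Thm-⊃⇒⊢ᴴ (ruleE (⊢ᴴ⇒Thm-⊃ (GDer-sound d)) (⊢ᴴ⇒Thm-⊃ (GDer-sound e)))
  GDer-sound (ruleEn {a = a} {as} _ hC d es) = Thm-⋀⊃⇒⊢ᴴ (Thm-⊃-trans (Thm-□-⋀ hC a as)
    (ruleE (⊢ᴴ⇒Thm-⋀⊃ (GDer-sound d)) (Thm-⊃-⋀ (All.map ⊢ᴴ⇒Thm-⊃ (GDer-sound-All es)))))
  GDer-sound (ruleM hM _ d) = Thm-⊃⇒⊢ᴴ (Thm-□-mono hM (⊢ᴴ⇒Thm-⊃ (GDer-sound d)))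
  GDer-sound (ruleMn {a = a} {as} hM hC d) = Thm-⋀⊃⇒⊢ᴴ (Thm-⊃-trans (Thm-□-⋀ hC a as)
    (Thm-□-mono hM (⊢ᴴ⇒Thm-⋀⊃ (GDer-sound d))))
  GDer-sound (ruleN hN d) = Thm⇒⊢ᴴ (Thm-□-nec hN (⊢ᴴ⇒Thm (GDer-sound d)))

  GDer-sound-All : ∀ {I : Set} {is : List I} {f : I → Seq} →
                   All (GDer 𝒜 ∘ f) is → All (𝒜 ⊢ᴴ_ ∘ f) is
  GDer-sound-All []       = []
  GDer-sound-All (d ∷ ds) = GDer-sound d ∷ GDer-sound-All ds

mainTheorem10 : (𝒜 : Axioms) →
    ((Γ Δ : List Fm) → LDer 𝒜 false (last (Γ , Δ)) → GDer 𝒜 (Γ , Δ))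
    × ((A : Fm) → LDer 𝒜 true (last ([] , [ A ])) → Thm 𝒜 A)
mainTheorem10 𝒜 = (λ _ _ → LDer⇒⊢ᴳ) , (λ _ → ⊢ᴴ⇒Thm ∘ GDer-sound ∘ LDer⇒⊢ᴳ)
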